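{- Let $q$ be a prime power, $r\ge1$, and let $(G,R)$ be a $2$-coloring of $AG(r-1,q)$. Assume $AG(r-1,q)|G$ is a minimal affine-non-target of rank $r$. Then $r(R)=r$.
   Context: $AG(r-1,q)$ denotes the rank-$r$ affine geometry over $GF(q)$; its flats are affine flats, and for a nonempty affine flat $X$, $AG(r-1,q)|X$ is an affine geometry of rank $r(X)$. A $2$-coloring $(G,R)$ of $AG(r-1,q)$ is a partition of its ground set into possibly empty sets $G$ and $R$. In an affine geometry $A$, $A|Y$ is an affine target if there is a sequence $(F_0,\dots,F_k)$ of possibly empty affine flats of $A$ with $\emptyset=F_0\subseteq\dots\subseteq F_k=E(A)$ such that $Y$ is the union of the sets $F_{i+1}-F_i$ over all even $i$ with $0\le i\le k-1$. $AG(r-1,q)|G$ is a minimal affine-non-target if it is not an affine target but every proper induced restriction of it is an affine target, i.e. for every affine flat $X$ with $G\cap X\neq G$, the set $G\cap X$ is an affine target in the affine geometry $AG(r-1,q)|X$. -}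

module Defs where

open import Level using (0ℓ)
open import Data.Nat using (ℕ; zero; suc; _≤_; _^_; _%_)
open import Data.Nat.Primality using (Prime)
open import Data.Fin using (Fin; zero; suc; inject₁; fromℕ; toℕ)
open import Data.Vec using (Vec; zipWith; map; replicate)
open import Data.Bool using (Bool; true; false)
open import Data.Product using (Σ; ∃; _×_; _,_)
open import Data.Empty using (⊥)
open import Relation.Nullary using (¬_)
open import Relation.Unary using (Pred)
open import Relation.Binary.PropositionalEquality using (_≡_; _≢_)
open import Algebra.Structures using (IsCommutativeRing)

IsPrimePower : ℕ → Set
IsPrimePower q = Σ ℕ λ p → Σ ℕ λ k → Prime p × (1 ≤ k) × (q ≡ p ^ k)

-- A field structure on the q-element set Fin q.
-- (Every field with q elements is GF(q), up to isomorphism.)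
record FieldOn (q : ℕ) : Set where
  infixl 6 _+_
  infixl 7 _*_
  field
    _+_ : Fin q → Fin q → Fin q
    _*_ : Fin q → Fin q → Fin q
    -_  : Fin q → Fin q
    0#  : Fin q
    1#  : Fin q
    isCommutativeRing : IsCommutativeRing _≡_ _+_ _*_ -_ 0# 1#
    0≢1 : 0# ≢ 1#
    inverse : ∀ x → x ≢ 0# → ∃ λ y → x * y ≡ 1#

module AffineGeometry {q : ℕ} (𝔽 : FieldOn q) (n : ℕ) where
  open FieldOn 𝔽

  -- points of AG(n, q) = GF(q)^n  (rank n+1)
  Point : Set
  Point = Vec (Fin q) n

  _⊕_ : Point → Point → Point
  _⊕_ = zipWith _+_

  _·_ : Fin q → Point → Point
  c · v = map (c *_) v

  𝟎 : Point
  𝟎 = replicate n 0#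

  Σₛ : ∀ {k} → (Fin k → Fin q) → Fin q
  Σₛ {zero}  f = 0#
  Σₛ {suc k} f = f zero + Σₛ (λ i → f (suc i))

  Σᵥ : ∀ {k} → (Fin k → Point) → Point
  Σᵥ {zero}  f = 𝟎
  Σᵥ {suc k} f = f zero ⊕ Σᵥ (λ i → f (suc i))

  Subset : Set₁
  Subset = Pred Point 0ℓ

  IsFlat : Subset → Set
  IsFlat X = ∀ (k : ℕ) (ps : Fin k → Point) (cs : Fin k → Fin q) →
             (∀ i → X (ps i)) → Σₛ cs ≡ 1# → X (Σᵥ (λ i → cs i · ps i))

  AffinelyIndependent : ∀ {k} → (Fin k → Point) → Set
  AffinelyIndependent {k} ps = ∀ (cs : Fin k → Fin q) →
    Σₛ cs ≡ 0# → Σᵥ (λ i → cs i · ps i) ≡ 𝟎 → ∀ i → cs i ≡ 0#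

  HasRank : Subset → ℕ → Set
  HasRank S m =
    (Σ (Fin m → Point) λ ps → (∀ i → S (ps i)) × AffinelyIndependent ps) ×
    (∀ k (ps : Fin k → Point) → (∀ i → S (ps i)) → AffinelyIndependent ps → k ≤ m)

  IsAffineTarget : Subset → Subset → Set₁
  IsAffineTarget X Y =
    Σ ℕ λ k → Σ (Fin (suc k) → Subset) λ F →
      (∀ i → IsFlat (F i)) ×
      (∀ (i : Fin k) x → F (inject₁ i) x → F (suc i) x) ×
      (∀ x → ¬ F zero x) ×
      (∀ x → (F (fromℕ k) x → X x) × (X x → F (fromℕ k) x)) ×
      (∀ x → X x →
         (Y x → Σ (Fin k) λ i → (toℕ i % 2 ≡ 0) × F (suc i) x × ¬ F (inject₁ i) x) ×
         (Σ (Fin k) (λ i → (toℕ i % 2 ≡ 0) × F (suc i) x × ¬ F (inject₁ i) x) → Y x))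

  E : Subset
  E _ = Data.Unit.⊤
    where import Data.Unit

  IsMinimalAffineNonTarget : Subset → Set₁
  IsMinimalAffineNonTarget G =
    (¬ IsAffineTarget E G) ×
    (∀ (X : Subset) → IsFlat X → ¬ (∀ x → G x → X x) →
       IsAffineTarget X (λ x → G x × X x))

{-# OPTIONS --safe #-}
-- Let X be the affine closure of the red points: a flat containing R, and a decidable one
-- since the space is finite.  If some green point lay outside X, minimality would make
-- G ∩ X an affine target in AG|X; topping its chain of flats with the whole space (after
-- repeating the last flat if needed, to make the new layer even) would exhibit G itself as
-- an affine target, which it is not.  So G ⊆ X, and the r affinely independent green points
-- force r affinely independent points among the red ones (Steinitz exchange in the
-- homogeneous coordinates (1, p)); rank r is also the largest possible.
module Submission where

open import Defs
open import Level using (0ℓ)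
open import Data.Nat using (ℕ; zero; suc; _≤_; _∸_; _%_; z≤n; s≤s)
open import Data.Nat.Properties using (m≤n⇒m≤1+n)
import Data.Nat.Properties as ℕₚ
open import Data.Nat.DivMod using ([m+n]%n≡m%n)
open import Data.Fin using (Fin; zero; suc; toℕ; inject₁; fromℕ; punchIn)
open import Data.Fin.Properties using (_≟_; all?; ¬∀⟶∃¬; toℕ-inject₁; toℕ-fromℕ)
open import Data.Fin.Relation.Unary.Top using (view; ‵fromℕ; ‵inject₁)
open import Data.Vec as Vec using (Vec)
open import Data.Vec.Properties using (lookup∘tabulate; lookup-map; lookup-zipWith; lookup-replicate; tabulate∘lookup; tabulate-cong)
open import Data.Vec.Functional using (Vector; _∷_; insertAt)
open import Data.Vec.Functional.Properties using (insertAt-lookup; insertAt-punchIn)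
open import Data.List as List using (List; [_]; concatMap; filter; allFin; length)
open import Data.List.Relation.Unary.Any as Any using (here; any?; satisfied)
open import Data.List.Relation.Unary.Any.Properties using (lookup-index)
open import Data.List.Membership.Propositional using (_∈_; lose)
open import Data.List.Membership.Propositional.Properties
  using (∈-concatMap⁺; ∈-map⁺; ∈-allFin; ∈-lookup; ∈-filter⁺; ∈-filter⁻)
open import Data.Bool as Bool using (Bool; true; false)
open import Data.Product using (Σ; ∃; _×_; _,_; proj₁; proj₂)
open import Data.Sum using (_⊎_; inj₁; inj₂)
open import Data.Unit using (tt)
open import Data.Empty using (⊥-elim)
open import Relation.Nullary using (¬_; Dec; yes; no; contradiction)
open import Relation.Unary using (Decidable)
open import Relation.Binary.PropositionalEquality
  using (_≡_; _≢_; refl; sym; trans; cong; cong₂; subst; _≗_; module ≡-Reasoning)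
open import Algebra.Bundles using (CommutativeRing)
open import Function using (_∘_; const)

parity : ∀ k → k % 2 ≡ 0 ⊎ suc k % 2 ≡ 0
parity zero = inj₁ refl
parity (suc k) with parity k
... | inj₁ even = inj₂ (trans (cong (_% 2) (ℕₚ.+-comm 2 k)) (trans ([m+n]%n≡m%n k 2) even))
... | inj₂ even = inj₁ even

module _ {a} {A : Set a} where

  snoc : ∀ {k} → (Fin (suc k) → A) → A → Fin (suc (suc k)) → A
  snoc f x zero = f zero
  snoc {zero} f x (suc zero) = x
  snoc {suc k} f x (suc i) = snoc (f ∘ suc) x i

  snoc-inject₁ : ∀ {k} (f : Fin (suc k) → A) x i → snoc f x (inject₁ i) ≡ f i
  snoc-inject₁ f x zero = refl
  snoc-inject₁ {suc k} f x (suc i) = snoc-inject₁ (f ∘ suc) x i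

  snoc-fromℕ : ∀ {k} (f : Fin (suc k) → A) x → snoc f x (fromℕ (suc k)) ≡ x
  snoc-fromℕ {zero} f x = refl
  snoc-fromℕ {suc k} f x = snoc-fromℕ (f ∘ suc) x

  snoc-all : ∀ {p} {P : A → Set p} {k} (f : Fin (suc k) → A) x →
             (∀ i → P (f i)) → P x → ∀ i → P (snoc f x i)
  snoc-all f x Pf Px zero = Pf zero
  snoc-all {k = zero} f x Pf Px (suc zero) = Px
  snoc-all {k = suc k} f x Pf Px (suc i) = snoc-all (f ∘ suc) x (Pf ∘ suc) Px i

vectors : ∀ {a} {A : Set a} → List A → ∀ m → List (Vec A m)
vectors xs zero = [ Vec.[] ]
vectors xs (suc m) = concatMap (λ x → List.map (x Vec.∷_) (vectors xs m)) xs

∈-vectors : ∀ {a} {A : Set a} {xs : List A} → (∀ x → x ∈ xs) → ∀ {m} (v : Vec A m) → v ∈ vectors xs m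
∈-vectors xs-complete Vec.[] = here refl
∈-vectors {xs = xs} xs-complete (x Vec.∷ v) =
  ∈-concatMap⁺ (λ y → List.map (y Vec.∷_) (vectors xs _))
    (Any.map (λ { refl → ∈-map⁺ (x Vec.∷_) (∈-vectors xs-complete v) }) (xs-complete x))

module LinearAlgebra {q : ℕ} (𝔽 : FieldOn q) where
  open FieldOn 𝔽 using (isCommutativeRing; 0≢1; inverse)

  𝔽-ring : CommutativeRing 0ℓ 0ℓ
  𝔽-ring = record { isCommutativeRing = isCommutativeRing }

  open CommutativeRing 𝔽-ring
    using (_+_; _*_; -_; 0#; 1#; +-comm; *-comm; *-assoc; distribˡ; distribʳ;
           +-identityˡ; +-identityʳ; *-identityˡ; *-identityʳ; zeroˡ; -‿inverseʳ; semiring; ring)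
  open import Algebra.Properties.Semiring.Sum semiring
    using (sum; sum-cong-≗; ∑-comm; ∑-distrib-+; *-distribˡ-sum; *-distribʳ-sum; sum-remove; sum-replicate-zero)
  open import Algebra.Properties.Ring ring using (-‿distribˡ-*; -‿distribʳ-*; +-inverseʳ-unique)
  open ≡-Reasoning

  Scalar : Set
  Scalar = Fin q

  lincomb : ∀ {m d} → Vector Scalar m → Vector (Vector Scalar d) m → Vector Scalar d
  lincomb c v l = sum λ i → c i * v i l

  LinearlyIndependent : ∀ {m d} → Vector (Vector Scalar d) m → Set
  LinearlyIndependent v = ∀ c → lincomb c v ≗ const 0# → c ≗ const 0#

  InSpan : ∀ {k d} → Vector (Vector Scalar d) k → Vector Scalar d → Set
  InSpan w x = ∃ λ c → lincomb c w ≗ x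

  δ : ∀ {k} → Fin k → Fin k → Scalar
  δ zero zero = 1#
  δ zero (suc _) = 0#
  δ (suc _) zero = 0#
  δ (suc i) (suc j) = δ i j

  δ-sym : ∀ {k} (i j : Fin k) → δ i j ≡ δ j i
  δ-sym zero zero = refl
  δ-sym zero (suc j) = refl
  δ-sym (suc i) zero = refl
  δ-sym (suc i) (suc j) = δ-sym i j

  sum-zero : ∀ {m} (f : Vector Scalar m) → f ≗ const 0# → sum f ≡ 0#
  sum-zero {m} f f≗0 = trans (sum-cong-≗ f≗0) (sum-replicate-zero m)

  sum-δ : ∀ {k} (i : Fin k) (f : Vector Scalar k) → sum (λ j → δ i j * f j) ≡ f i
  sum-δ {suc k} zero f = begin
    1# * f zero + sum (λ j → 0# * f (suc j)) ≡⟨ cong₂ _+_ (*-identityˡ (f zero)) (sum-zero _ (zeroˡ ∘ f ∘ suc)) ⟩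
    f zero + 0#                              ≡⟨ +-identityʳ (f zero) ⟩
    f zero                                   ∎
  sum-δ {suc k} (suc i) f = trans (cong₂ _+_ (zeroˡ (f zero)) (sum-δ i (f ∘ suc))) (+-identityˡ _)

  lincomb-congˡ : ∀ {m d} {c c' : Vector Scalar m} (v : Vector (Vector Scalar d) m) →
                  c ≗ c' → lincomb c v ≗ lincomb c' v
  lincomb-congˡ v c≗c' l = sum-cong-≗ λ i → cong (_* v i l) (c≗c' i)

  lincomb-congʳ : ∀ {m d} (c : Vector Scalar m) {v v' : Vector (Vector Scalar d) m} →
                  (∀ i → v i ≗ v' i) → lincomb c v ≗ lincomb c v'
  lincomb-congʳ c v≗v' l = sum-cong-≗ λ i → cong (c i *_) (v≗v' i l)

  lincomb-+ˡ : ∀ {m d} (c c' : Vector Scalar m) (v : Vector (Vector Scalar d) m) l →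
               lincomb (λ i → c i + c' i) v l ≡ lincomb c v l + lincomb c' v l
  lincomb-+ˡ c c' v l =
    trans (sum-cong-≗ λ i → distribʳ (v i l) (c i) (c' i)) (∑-distrib-+ (λ i → c i * v i l) (λ i → c' i * v i l))

  lincomb-*ˡ : ∀ {m d} a (c : Vector Scalar m) (v : Vector (Vector Scalar d) m) l →
               lincomb (λ i → a * c i) v l ≡ a * lincomb c v l
  lincomb-*ˡ a c v l = trans (sum-cong-≗ λ i → *-assoc a (c i) (v i l)) (sym (*-distribˡ-sum a (λ i → c i * v i l)))

  lincomb-+ʳ : ∀ {m d} (c : Vector Scalar m) (v v' : Vector (Vector Scalar d) m) l →
               lincomb c (λ i l → v i l + v' i l) l ≡ lincomb c v l + lincomb c v' l
  lincomb-+ʳ c v v' l =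
    trans (sum-cong-≗ λ i → distribˡ (c i) (v i l) (v' i l)) (∑-distrib-+ (λ i → c i * v i l) (λ i → c i * v' i l))

  lincomb-*ʳ : ∀ {m d} (c s : Vector Scalar m) (x : Vector Scalar d) l →
               lincomb c (λ i l → s i * x l) l ≡ sum (λ i → c i * s i) * x l
  lincomb-*ʳ c s x l =
    trans (sum-cong-≗ λ i → sym (*-assoc (c i) (s i) (x l))) (sym (*-distribʳ-sum (x l) (λ i → c i * s i)))

  lincomb-lincomb : ∀ {m k d} (c : Vector Scalar m) (A : Vector (Vector Scalar k) m)
                    (w : Vector (Vector Scalar d) k) l →
                    lincomb c (λ i → lincomb (A i) w) l ≡ lincomb (λ j → sum λ i → c i * A i j) w l
  lincomb-lincomb c A w l = begin
    sum (λ i → c i * sum (λ j → A i j * w j l))  ≡⟨ sum-cong-≗ (λ i → *-distribˡ-sum (c i) (λ j → A i j * w j l)) ⟩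
    sum (λ i → sum (λ j → c i * (A i j * w j l))) ≡⟨ ∑-comm (λ i j → c i * (A i j * w j l)) ⟩
    sum (λ j → sum (λ i → c i * (A i j * w j l))) ≡⟨ sum-cong-≗ (λ j → sum-cong-≗ (λ i → sym (*-assoc (c i) (A i j) (w j l)))) ⟩
    sum (λ j → sum (λ i → c i * A i j * w j l))   ≡⟨ sum-cong-≗ (λ j → sym (*-distribʳ-sum (w j l) (λ i → c i * A i j))) ⟩
    sum (λ j → sum (λ i → c i * A i j) * w j l)   ∎

  lincomb-tail : ∀ {k d} {c : Vector Scalar (suc k)} (w : Vector (Vector Scalar d) (suc k)) →
                 c zero ≡ 0# → lincomb (c ∘ suc) (w ∘ suc) ≗ lincomb c w
  lincomb-tail {c = c} w c₀≡0 l = sym (begin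
    c zero * w zero l + lincomb (c ∘ suc) (w ∘ suc) l ≡⟨ cong (λ a → a * w zero l + lincomb (c ∘ suc) (w ∘ suc) l) c₀≡0 ⟩
    0# * w zero l + lincomb (c ∘ suc) (w ∘ suc) l    ≡⟨ cong (_+ lincomb (c ∘ suc) (w ∘ suc) l) (zeroˡ (w zero l)) ⟩
    0# + lincomb (c ∘ suc) (w ∘ suc) l               ≡⟨ +-identityˡ _ ⟩
    lincomb (c ∘ suc) (w ∘ suc) l                    ∎)

  InSpan-member : ∀ {k d} (w : Vector (Vector Scalar d) k) i → InSpan w (w i)
  InSpan-member w i = δ i , λ l → sum-δ i (λ j → w j l)

  InSpan-trans : ∀ {m k d} {w : Vector (Vector Scalar d) m} {v : Vector (Vector Scalar d) k} {x} →
                 (∀ i → InSpan v (w i)) → InSpan w x → InSpan v x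
  InSpan-trans {w = w} {v} {x} w⊆v (c , c·w≗x) = (λ j → sum λ i → c i * proj₁ (w⊆v i) j) , λ l → begin
    lincomb (λ j → sum λ i → c i * proj₁ (w⊆v i) j) v l ≡⟨ lincomb-lincomb c (proj₁ ∘ w⊆v) v l ⟨
    lincomb c (λ i → lincomb (proj₁ (w⊆v i)) v) l      ≡⟨ lincomb-congʳ c (proj₂ ∘ w⊆v) l ⟩
    lincomb c w l                                       ≡⟨ c·w≗x l ⟩
    x l                                                 ∎

  InSpan-sub : ∀ {m k d} (σ : Fin m → Fin k) (v : Vector (Vector Scalar d) k) {x} →
               InSpan (v ∘ σ) x → InSpan v x
  InSpan-sub σ v = InSpan-trans (InSpan-member v ∘ σ)

  InSpan-δ : ∀ {d} (x : Vector Scalar d) → InSpan δ x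
  InSpan-δ x = x , λ l → trans (sum-cong-≗ λ j → trans (*-comm (x j) (δ j l)) (cong (_* x j) (δ-sym j l))) (sum-δ l x)

  InSpan? : ∀ {k d} (w : Vector (Vector Scalar d) k) x → Dec (InSpan w x)
  InSpan? {k} w x with any? (λ c → all? λ l → lincomb (Vec.lookup c) w l ≟ x l) (vectors (allFin q) k)
  ... | yes found = let (c , c·w≗x) = satisfied found in yes (Vec.lookup c , c·w≗x)
  ... | no none = no λ (c , c·w≗x) → none (lose (∈-vectors ∈-allFin (Vec.tabulate c))
                    λ l → trans (lincomb-congˡ w (lookup∘tabulate c) l) (c·w≗x l))

  inverse-solves : ∀ {a γ} x y → γ * a ≡ 1# → a * x + y ≡ 0# → x ≡ (- γ) * y
  inverse-solves {a} {γ} x y γa≡1 ax+y≡0 = begin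
    x              ≡⟨ *-identityˡ x ⟨
    1# * x         ≡⟨ cong (_* x) γa≡1 ⟨
    γ * a * x      ≡⟨ *-assoc γ a x ⟩
    γ * (a * x)    ≡⟨ cong (γ *_) (+-inverseʳ-unique y (a * x) (trans (+-comm y (a * x)) ax+y≡0)) ⟩
    γ * (- y)      ≡⟨ -‿distribʳ-* γ y ⟨
    - (γ * y)      ≡⟨ -‿distribˡ-* γ y ⟩
    (- γ) * y      ∎

  pivot-cancels : ∀ {α β} a → α * β ≡ 1# → a + (- (a * β)) * α ≡ 0#
  pivot-cancels {α} {β} a αβ≡1 = begin
    a + (- (a * β)) * α ≡⟨ cong (a +_) (-‿distribˡ-* (a * β) α) ⟨
    a + - (a * β * α)   ≡⟨ cong (λ t → a + - t) (*-assoc a β α) ⟩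
    a + - (a * (β * α)) ≡⟨ cong (λ t → a + - (a * t)) (trans (*-comm β α) αβ≡1) ⟩
    a + - (a * 1#)      ≡⟨ cong (λ t → a + - t) (*-identityʳ a) ⟩
    a + - a             ≡⟨ -‿inverseʳ a ⟩
    0#                  ∎

  LinearlyIndependent-∷ : ∀ {m d} {x : Vector Scalar d} {v : Vector (Vector Scalar d) m} →
                          ¬ InSpan v x → LinearlyIndependent v → LinearlyIndependent (x ∷ v)
  LinearlyIndependent-∷ {x = x} {v} x∉span indep c c·x∷v≗0 with c zero ≟ 0#
  ... | yes c₀≡0 = λ { zero → c₀≡0
                     ; (suc i) → indep (c ∘ suc) (λ l → trans (lincomb-tail {c = c} (x ∷ v) c₀≡0 l) (c·x∷v≗0 l)) i }
  ... | no c₀≢0 = ⊥-elim (x∉span ((λ j → (- γ) * c (suc j)) , λ l →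
                    trans (lincomb-*ˡ (- γ) (c ∘ suc) v l)
                          (sym (inverse-solves (x l) (lincomb (c ∘ suc) v l) γc₀≡1 (c·x∷v≗0 l)))))
    where
      γ : Scalar
      γ = proj₁ (inverse (c zero) c₀≢0)
      γc₀≡1 : γ * c zero ≡ 1#
      γc₀≡1 = trans (*-comm γ (c zero)) (proj₂ (inverse (c zero) c₀≢0))

  LinearlyIndependent-shear : ∀ {m d} {u : Vector (Vector Scalar d) (suc m)} → LinearlyIndependent u →
                              ∀ p (s : Vector Scalar m) →
                              LinearlyIndependent (λ j l → u (punchIn p j) l + s j * u p l)
  LinearlyIndependent-shear {u = u} indep p s c c·u'≗0 j =
    trans (sym (insertAt-punchIn c p t j)) (indep C C·u≗0 (punchIn p j))
    where
      t : Scalar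
      t = sum λ j → c j * s j
      C : Vector Scalar _
      C = insertAt c p t
      u' : Vector (Vector Scalar _) _
      u' j l = u (punchIn p j) l + s j * u p l
      C·u≗0 : lincomb C u ≗ const 0#
      C·u≗0 l = begin
        lincomb C u l
          ≡⟨ sum-remove {i = p} (λ i → C i * u i l) ⟩
        C p * u p l + lincomb (C ∘ punchIn p) (u ∘ punchIn p) l
          ≡⟨ cong₂ _+_ (cong (_* u p l) (insertAt-lookup c p t)) (lincomb-congˡ (u ∘ punchIn p) (insertAt-punchIn c p t) l) ⟩
        t * u p l + lincomb c (u ∘ punchIn p) l
          ≡⟨ +-comm _ _ ⟩
        lincomb c (u ∘ punchIn p) l + t * u p l
          ≡⟨ cong (lincomb c (u ∘ punchIn p) l +_) (lincomb-*ʳ c s (u p) l) ⟨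
        lincomb c (u ∘ punchIn p) l + lincomb c (λ j l → s j * u p l) l
          ≡⟨ lincomb-+ʳ c (u ∘ punchIn p) (λ j l → s j * u p l) l ⟨
        lincomb c u' l
          ≡⟨ c·u'≗0 l ⟩
        0# ∎

  eliminate-head : ∀ {k m d} (w : Vector (Vector Scalar d) (suc k)) {u : Vector (Vector Scalar d) (suc m)} →
                   LinearlyIndependent u → (A : Vector (Vector Scalar (suc k)) (suc m)) →
                   (∀ i → lincomb (A i) w ≗ u i) → ∀ p → A p zero ≢ 0# →
                   Σ (Vector (Vector Scalar d) m) λ u' →
                     LinearlyIndependent u' × ∀ j → InSpan (w ∘ suc) (u' j)
  eliminate-head w {u} indep A A·w≗u p Ap₀≢0 =
    u' , LinearlyIndependent-shear {u = u} indep p s , λ j → A' j ∘ suc , A'·w≗u' j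
    where
      β : Scalar
      β = proj₁ (inverse (A p zero) Ap₀≢0)
      s : Vector Scalar _
      s j = - (A (punchIn p j) zero * β)
      u' : Vector (Vector Scalar _) _
      u' j l = u (punchIn p j) l + s j * u p l
      A' : Vector (Vector Scalar _) _
      A' j i = A (punchIn p j) i + s j * A p i
      A'·w≗u' : ∀ j → lincomb (A' j ∘ suc) (w ∘ suc) ≗ u' j
      A'·w≗u' j l = begin
        lincomb (A' j ∘ suc) (w ∘ suc) l
          ≡⟨ lincomb-tail {c = A' j} w (pivot-cancels (A (punchIn p j) zero) (proj₂ (inverse (A p zero) Ap₀≢0))) l ⟩
        lincomb (A' j) w l
          ≡⟨ lincomb-+ˡ (A (punchIn p j)) (λ i → s j * A p i) w l ⟩
        lincomb (A (punchIn p j)) w l + lincomb (λ i → s j * A p i) w l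
          ≡⟨ cong (lincomb (A (punchIn p j)) w l +_) (lincomb-*ˡ (s j) (A p) w l) ⟩
        lincomb (A (punchIn p j)) w l + s j * lincomb (A p) w l
          ≡⟨ cong₂ (λ a b → a + s j * b) (A·w≗u (punchIn p j) l) (A·w≗u p l) ⟩
        u' j l ∎

  IndependentSubfamily : ∀ {k d} → ℕ → Vector (Vector Scalar d) k → Set
  IndependentSubfamily {k} m w = m ≤ k × Σ (Fin m → Fin k) λ σ → LinearlyIndependent (w ∘ σ)

  IndependentSubfamily-tail : ∀ {k d m} (w : Vector (Vector Scalar d) (suc k)) →
                              IndependentSubfamily m (w ∘ suc) → IndependentSubfamily m w
  IndependentSubfamily-tail w (m≤k , σ , indep) = m≤n⇒m≤1+n m≤k , suc ∘ σ , indep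

  -- Steinitz exchange: the first vector of w is either redundant, unused by the u's, or can be
  -- eliminated from all u's but one pivot.
  independentSubfamily : ∀ k m {d} (w : Vector (Vector Scalar d) k) {u : Vector (Vector Scalar d) m} →
                         LinearlyIndependent u → (∀ i → InSpan w (u i)) → IndependentSubfamily m w
  independentSubfamily k zero w _ _ = z≤n , (λ ()) , (λ _ _ ())
  independentSubfamily zero (suc m) w {u} indep u⊆span =
    ⊥-elim (0≢1 (sym (indep (δ zero) (λ l → trans (sum-δ zero (λ i → u i l)) (sym (proj₂ (u⊆span zero) l))) zero)))
  independentSubfamily (suc k) (suc m) w {u} indep u⊆span with InSpan? (w ∘ suc) (w zero)
  ... | yes w₀∈span = IndependentSubfamily-tail w (independentSubfamily k (suc m) (w ∘ suc) indep
                        λ i → InSpan-trans {w = w} (λ { zero → w₀∈span ; (suc j) → InSpan-member (w ∘ suc) j }) (u⊆span i))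
  ... | no w₀∉span with all? (λ i → proj₁ (u⊆span i) zero ≟ 0#)
  ... | yes no-head = IndependentSubfamily-tail w (independentSubfamily k (suc m) (w ∘ suc) indep
                        λ i → proj₁ (u⊆span i) ∘ suc , λ l → trans (lincomb-tail {c = proj₁ (u⊆span i)} w (no-head i) l) (proj₂ (u⊆span i) l))
  ... | no some-head =
    let (p , Ap₀≢0) = ¬∀⟶∃¬ _ _ (λ i → proj₁ (u⊆span i) zero ≟ 0#) some-head
        (u' , indep' , u'⊆span) = eliminate-head w indep (proj₁ ∘ u⊆span) (proj₂ ∘ u⊆span) p Ap₀≢0
        (m≤k , σ , indepσ) = independentSubfamily k m (w ∘ suc) indep' u'⊆span
    in s≤s m≤k , zero ∷ suc ∘ σ , LinearlyIndependent-∷ (w₀∉span ∘ InSpan-sub σ (w ∘ suc)) indepσ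

module AffineSpace {q : ℕ} (𝔽 : FieldOn q) (n : ℕ) where
  open AffineGeometry 𝔽 n
  open LinearAlgebra 𝔽

  Layer : ∀ {k} → (Fin (suc k) → Subset) → Fin k → Subset
  Layer F i x = (toℕ i % 2 ≡ 0) × F (suc i) x × ¬ F (inject₁ i) x

  -- IsAffineTarget X Y unfolds to Σ ℕ (TargetOfLength X Y).
  TargetOfLength : Subset → Subset → ℕ → Set₁
  TargetOfLength X Y k = Σ (Fin (suc k) → Subset) λ F →
    (∀ i → IsFlat (F i)) ×
    (∀ (i : Fin k) x → F (inject₁ i) x → F (suc i) x) ×
    (∀ x → ¬ F zero x) ×
    (∀ x → (F (fromℕ k) x → X x) × (X x → F (fromℕ k) x)) ×
    (∀ x → X x → (Y x → Σ (Fin k) λ i → Layer F i x) × (Σ (Fin k) (λ i → Layer F i x) → Y x))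

  module _ {k} (F : Fin (suc k) → Subset) (A : Subset) where

    ∈snoc-inject₁⁺ : ∀ {i x} → F i x → snoc F A (inject₁ i) x
    ∈snoc-inject₁⁺ {i} {x} = subst (λ S → S x) (sym (snoc-inject₁ F A i))

    ∈snoc-inject₁⁻ : ∀ {i x} → snoc F A (inject₁ i) x → F i x
    ∈snoc-inject₁⁻ {i} {x} = subst (λ S → S x) (snoc-inject₁ F A i)

    ∈snoc-fromℕ⁺ : ∀ {x} → A x → snoc F A (fromℕ (suc k)) x
    ∈snoc-fromℕ⁺ {x} = subst (λ S → S x) (sym (snoc-fromℕ F A))

    ∈snoc-fromℕ⁻ : ∀ {x} → snoc F A (fromℕ (suc k)) x → A x
    ∈snoc-fromℕ⁻ {x} = subst (λ S → S x) (snoc-fromℕ F A)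

    Layer-snoc-inject₁⁺ : ∀ {i x} → Layer F i x → Layer (snoc F A) (inject₁ i) x
    Layer-snoc-inject₁⁺ {i} (even , in₊ , out) =
      subst (λ t → t % 2 ≡ 0) (sym (toℕ-inject₁ i)) even , ∈snoc-inject₁⁺ in₊ , out ∘ ∈snoc-inject₁⁻

    Layer-snoc-inject₁⁻ : ∀ {i x} → Layer (snoc F A) (inject₁ i) x → Layer F i x
    Layer-snoc-inject₁⁻ {i} (even , in₊ , out) =
      subst (λ t → t % 2 ≡ 0) (toℕ-inject₁ i) even , ∈snoc-inject₁⁻ in₊ , out ∘ ∈snoc-inject₁⁺

    snoc-chain : (∀ (i : Fin k) x → F (inject₁ i) x → F (suc i) x) → (∀ x → F (fromℕ k) x → A x) →
                 ∀ (i : Fin (suc k)) x → snoc F A (inject₁ i) x → snoc F A (suc i) x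
    snoc-chain chain top i x with view i
    ... | ‵fromℕ = ∈snoc-fromℕ⁺ ∘ top x ∘ ∈snoc-inject₁⁻
    ... | ‵inject₁ j = ∈snoc-inject₁⁺ ∘ chain j x ∘ ∈snoc-inject₁⁻

  pad : ∀ {X Y k} → TargetOfLength X Y k → TargetOfLength X Y (suc k)
  pad {X} {Y} {k} (F , flat , chain , empty , top , layers) =
    snoc F F⊤ , snoc-all {P = IsFlat} F F⊤ flat (flat (fromℕ k)) , snoc-chain F F⊤ chain (λ _ h → h) , empty ,
    (λ x → proj₁ (top x) ∘ ∈snoc-fromℕ⁻ F F⊤ , ∈snoc-fromℕ⁺ F F⊤ ∘ proj₂ (top x)) ,
    λ x Xx → (λ Yx → let (i , L) = proj₁ (layers x Xx) Yx in inject₁ i , Layer-snoc-inject₁⁺ F F⊤ L) ,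
             λ (i , L) → fromLayer x Xx i L
    where
      F⊤ : Subset
      F⊤ = F (fromℕ k)
      fromLayer : ∀ x → X x → (i : Fin (suc k)) → Layer (snoc F F⊤) i x → Y x
      fromLayer x Xx i L with view i
      ... | ‵inject₁ j = proj₂ (layers x Xx) (j , Layer-snoc-inject₁⁻ F F⊤ L)
      ... | ‵fromℕ = contradiction (∈snoc-fromℕ⁻ F F⊤ (proj₁ (proj₂ L))) (proj₂ (proj₂ L) ∘ ∈snoc-inject₁⁺ F F⊤)

  extend-even : ∀ {X Y k} → Decidable X → (∀ x → ¬ X x → Y x) → k % 2 ≡ 0 →
                TargetOfLength X (λ x → Y x × X x) k → TargetOfLength E Y (suc k)
  extend-even {X} {Y} {k} X? outside⊆Y even (F , flat , chain , empty , top , layers) =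
    snoc F E , snoc-all {P = IsFlat} F E flat (λ _ _ _ _ _ → tt) , snoc-chain F E chain (λ _ _ → tt) , empty ,
    (λ _ → (λ _ → tt) , λ _ → ∈snoc-fromℕ⁺ F E tt) ,
    λ x _ → toLayer x , fromLayer x
    where
      toLayer : ∀ x → Y x → Σ (Fin (suc k)) λ i → Layer (snoc F E) i x
      toLayer x Yx with X? x
      ... | yes Xx = let (i , L) = proj₁ (layers x Xx) (Yx , Xx) in inject₁ i , Layer-snoc-inject₁⁺ F E L
      ... | no ¬Xx = fromℕ k , subst (λ t → t % 2 ≡ 0) (sym (toℕ-fromℕ k)) even ,
                     ∈snoc-fromℕ⁺ F E tt , ¬Xx ∘ proj₁ (top x) ∘ ∈snoc-inject₁⁻ F E
      fromLayer : ∀ x → Σ (Fin (suc k)) (λ i → Layer (snoc F E) i x) → Y x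
      fromLayer x (i , L) with X? x | view i
      ... | no ¬Xx | _ = outside⊆Y x ¬Xx
      ... | yes Xx | ‵inject₁ j = proj₁ (proj₂ (layers x Xx) (j , Layer-snoc-inject₁⁻ F E L))
      ... | yes Xx | ‵fromℕ = contradiction (∈snoc-inject₁⁺ F E (proj₂ (top x) Xx)) (proj₂ (proj₂ L))

  extend : ∀ {X Y} → Decidable X → (∀ x → ¬ X x → Y x) →
           IsAffineTarget X (λ x → Y x × X x) → IsAffineTarget E Y
  extend X? outside⊆Y (k , T) with parity k
  ... | inj₁ even = suc k , extend-even X? outside⊆Y even T
  ... | inj₂ even = suc (suc k) , extend-even X? outside⊆Y even (pad T)

  minimal-non-target-⊆ : ∀ {G X} → IsMinimalAffineNonTarget G → IsFlat X → Decidable X →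
                         (∀ x → ¬ X x → G x) → ∀ x → G x → X x
  minimal-non-target-⊆ {X = X} (¬target , minimal) X-flat X? outside⊆G x Gx with X? x
  ... | yes Xx = Xx
  ... | no ¬Xx = ⊥-elim (¬target (extend X? outside⊆G (minimal X X-flat λ G⊆X → ¬Xx (G⊆X x Gx))))

  open CommutativeRing 𝔽-ring using (_+_; _*_; 0#; 1#; *-identityʳ; semiring)
  open import Algebra.Properties.Semiring.Sum semiring using (sum; sum-cong-≗)

  homogenize : Point → Vector Scalar (suc n)
  homogenize p zero = 1#
  homogenize p (suc l) = Vec.lookup p l

  Σₛ≡sum : ∀ {k} (f : Vector Scalar k) → Σₛ f ≡ sum f
  Σₛ≡sum {zero} f = refl
  Σₛ≡sum {suc k} f = cong (f zero +_) (Σₛ≡sum (f ∘ suc))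

  lookup-Σᵥ : ∀ {k} (f : Fin k → Point) l → Vec.lookup (Σᵥ f) l ≡ sum λ i → Vec.lookup (f i) l
  lookup-Σᵥ {zero} f l = lookup-replicate l 0#
  lookup-Σᵥ {suc k} f l =
    trans (lookup-zipWith _+_ l (f zero) (Σᵥ (f ∘ suc))) (cong (Vec.lookup (f zero) l +_) (lookup-Σᵥ (f ∘ suc) l))

  lookup-combination : ∀ {k} (cs : Vector Scalar k) (ps : Fin k → Point) l →
                       Vec.lookup (Σᵥ λ i → cs i · ps i) l ≡ lincomb cs (homogenize ∘ ps) (suc l)
  lookup-combination cs ps l =
    trans (lookup-Σᵥ (λ i → cs i · ps i) l) (sum-cong-≗ λ i → lookup-map l (cs i *_) (ps i))

  lincomb-homogenize-zero : ∀ {k} (cs : Vector Scalar k) (ps : Fin k → Point) →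
                            lincomb cs (homogenize ∘ ps) zero ≡ Σₛ cs
  lincomb-homogenize-zero cs ps = trans (sum-cong-≗ (*-identityʳ ∘ cs)) (sym (Σₛ≡sum cs))

  homogenize-combination : ∀ {k} (cs : Vector Scalar k) (ps : Fin k → Point) → Σₛ cs ≡ 1# →
                           homogenize (Σᵥ λ i → cs i · ps i) ≗ lincomb cs (homogenize ∘ ps)
  homogenize-combination cs ps Σcs≡1 zero = sym (trans (lincomb-homogenize-zero cs ps) Σcs≡1)
  homogenize-combination cs ps Σcs≡1 (suc l) = lookup-combination cs ps l

  AffinelyIndependent⇒LinearlyIndependent : ∀ {k} (ps : Fin k → Point) →
    AffinelyIndependent ps → LinearlyIndependent (homogenize ∘ ps)
  AffinelyIndependent⇒LinearlyIndependent ps indep c c·ps≗0 =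
    indep c (trans (sym (lincomb-homogenize-zero c ps)) (c·ps≗0 zero))
      (trans (sym (tabulate∘lookup _)) (trans (tabulate-cong λ l →
        trans (lookup-combination c ps l) (trans (c·ps≗0 (suc l)) (sym (lookup-replicate l 0#))))
        (tabulate∘lookup 𝟎)))

  LinearlyIndependent⇒AffinelyIndependent : ∀ {k} (ps : Fin k → Point) →
    LinearlyIndependent (homogenize ∘ ps) → AffinelyIndependent ps
  LinearlyIndependent⇒AffinelyIndependent ps indep cs Σcs≡0 Σcsps≡𝟎 = indep cs λ
    { zero → trans (lincomb-homogenize-zero cs ps) Σcs≡0
    ; (suc l) → trans (sym (lookup-combination cs ps l))
                      (trans (cong (λ v → Vec.lookup v l) Σcsps≡𝟎) (lookup-replicate l 0#)) }

  AffinelyIndependent⇒≤ : ∀ {k} (ps : Fin k → Point) → AffinelyIndependent ps → k ≤ suc n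
  AffinelyIndependent⇒≤ {k} ps indep =
    proj₁ (independentSubfamily (suc n) k δ (AffinelyIndependent⇒LinearlyIndependent ps indep)
                                (InSpan-δ ∘ homogenize ∘ ps))

  AffineSpan : ∀ {K} → (Fin K → Point) → Subset
  AffineSpan w p = InSpan (homogenize ∘ w) (homogenize p)

  AffineSpan-flat : ∀ {K} (w : Fin K → Point) → IsFlat (AffineSpan w)
  AffineSpan-flat w k ps cs ps∈span Σcs≡1 =
    InSpan-trans ps∈span (cs , λ l → sym (homogenize-combination cs ps Σcs≡1 l))

  AffineSpan? : ∀ {K} (w : Fin K → Point) → Decidable (AffineSpan w)
  AffineSpan? w p = InSpan? (homogenize ∘ w) (homogenize p)

  AffineSpan-member : ∀ {K} (w : Fin K → Point) i → AffineSpan w (w i)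
  AffineSpan-member w = InSpan-member (homogenize ∘ w)

  affinelyIndependentSubfamily : ∀ {K m} (w : Fin K → Point) (ps : Fin m → Point) →
    AffinelyIndependent ps → (∀ i → AffineSpan w (ps i)) →
    Σ (Fin m → Fin K) λ σ → AffinelyIndependent (w ∘ σ)
  affinelyIndependentSubfamily {K} {m} w ps indep ps∈span =
    let (_ , σ , indepσ) = independentSubfamily K m (homogenize ∘ w)
                             (AffinelyIndependent⇒LinearlyIndependent ps indep) ps∈span
    in σ , LinearlyIndependent⇒AffinelyIndependent (w ∘ σ) indepσ

module RedPoints {q : ℕ} (𝔽 : FieldOn q) (n : ℕ) (colour : AffineGeometry.Point 𝔽 n → Bool) where
  open AffineGeometry 𝔽 n using (Point)
  open AffineSpace 𝔽 n using (AffineSpan; AffineSpan-member)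

  isRed? : Decidable λ p → colour p ≡ false
  isRed? p = colour p Bool.≟ false

  reds : List Point
  reds = filter isRed? (vectors (allFin q) n)

  red : Fin (length reds) → Point
  red = List.lookup reds

  red-isRed : ∀ i → colour (red i) ≡ false
  red-isRed i = proj₂ (∈-filter⁻ isRed? {xs = vectors (allFin q) n} (∈-lookup i))

  ∉AffineSpan⇒green : ∀ p → ¬ AffineSpan red p → colour p ≡ true
  ∉AffineSpan⇒green p p∉span with colour p in eq
  ... | true = refl
  ... | false = let p∈reds = ∈-filter⁺ isRed? (∈-vectors ∈-allFin p) eq
                in ⊥-elim (p∉span (subst (AffineSpan red) (sym (lookup-index p∈reds))
                                         (AffineSpan-member red (Any.index p∈reds))))

lemma4p11 : (q : ℕ) → IsPrimePower q → (𝔽 : FieldOn q) → (r : ℕ) → 1 ≤ r →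
    let open AffineGeometry 𝔽 (r ∸ 1) in
    (colour : Point → Bool) →
    IsMinimalAffineNonTarget (λ x → colour x ≡ true) →
    HasRank (λ x → colour x ≡ true) r →
    HasRank (λ x → colour x ≡ false) r
lemma4p11 q _ 𝔽 (suc n) (s≤s z≤n) colour minimal ((gs , gs-green , gs-indep) , _) =
  (red ∘ σ , red-isRed ∘ σ , redσ-indep) , λ k ps _ → AffinelyIndependent⇒≤ ps
  where
    open AffineGeometry 𝔽 n using (AffinelyIndependent)
    open AffineSpace 𝔽 n
    open RedPoints 𝔽 n colour
    green⊆span : ∀ p → colour p ≡ true → AffineSpan red p
    green⊆span = minimal-non-target-⊆ minimal (AffineSpan-flat red) (AffineSpan? red) ∉AffineSpan⇒green
    subfamily : Σ (Fin (suc n) → Fin (length reds)) λ σ → AffinelyIndependent (red ∘ σ)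
    subfamily = affinelyIndependentSubfamily red gs gs-indep (λ i → green⊆span (gs i) (gs-green i))
    σ : Fin (suc n) → Fin (length reds)
    σ = proj₁ subfamily
    redσ-indep : AffinelyIndependent (red ∘ σ)
    redσ-indep = proj₂ subfamily
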